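{- Let $k$ be a positive integer and let $A$ be the adjacency matrix of a regular tournament of order $2k+1$ (so every vertex has out-degree $k$). Then each of the block matrices $$B=\begin{bmatrix} A & A^T\\ A & A^T\end{bmatrix},\qquad C=\begin{bmatrix} A & A\\ A^T & A^T\end{bmatrix}$$ is the adjacency matrix of a directed strongly regular graph with parameters $(4k+2,\,2k,\,k,\,k-1,\,k)$.
   Context: A tournament is a directed graph without loops in which for every pair of distinct vertices $x,y$ exactly one of the arcs $x\to y$, $y\to x$ is present; its adjacency matrix $A$ (a $0/1$ matrix with $A_{ij}=1$ iff $x_i\to x_j$) satisfies $A+A^T=J-I$. It is regular if all out-degrees are equal. A directed strongly regular graph with parameters $(n,k,t,\lambda,\mu)$ is a directed graph on $n$ vertices (no loops, no multiple arcs) whose $0/1$ adjacency matrix $M$ satisfies $M^2=tI+\lambda M+\mu(J-I-M)$ and $MJ=JM=kJ$, where $I$ is the identity and $J$ the all-ones matrix of order $n$. -}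

module Defs where

open import Data.Nat using (ℕ; suc; _+_; _*_)
open import Data.Fin using (Fin; splitAt)
open import Data.Sum using (inj₁; inj₂)
open import Data.Product using (_×_)
open import Data.Integer as ℤ using (ℤ; +_)
open import Relation.Binary.PropositionalEquality using (_≡_; _≢_)
open import Relation.Nullary using (¬_)

Mat : ℕ → Set
Mat n = Fin n → Fin n → ℤ

∑ : {n : ℕ} → (Fin n → ℤ) → ℤ
∑ {ℕ.zero} f = + 0
∑ {suc n} f = f Data.Fin.zero ℤ.+ ∑ (λ i → f (Data.Fin.suc i))

_ᵀ : {n : ℕ} → Mat n → Mat n
(A ᵀ) i j = A j i

_·_ : {n : ℕ} → Mat n → Mat n → Mat n
(A · B) i j = ∑ (λ l → A i l ℤ.* B l j)

δ : {n : ℕ} → Fin n → Fin n → ℤ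
δ i j with i Data.Fin.≟ j
... | Relation.Nullary.yes _ = + 1
... | Relation.Nullary.no _ = + 0

I : {n : ℕ} → Mat n
I = δ

J : {n : ℕ} → Mat n
J _ _ = + 1

IsZeroOne : {n : ℕ} → Mat n → Set
IsZeroOne A = ∀ i j → (A i j ≡ + 0) Data.Sum.⊎ (A i j ≡ + 1)

IsTournament : {n : ℕ} → Mat n → Set
IsTournament A = IsZeroOne A × (∀ i j → A i j ℤ.+ A j i ≡ J i j ℤ.- I i j)

outdeg : {n : ℕ} → Mat n → Fin n → ℤ
outdeg A i = ∑ (λ j → A i j)

IsRegularTournament : {n : ℕ} → Mat n → ℕ → Set
IsRegularTournament A d = IsTournament A × (∀ i → outdeg A i ≡ + d)

IsDigraphAdj : {n : ℕ} → Mat n → Set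
IsDigraphAdj M = IsZeroOne M × (∀ i → M i i ≡ + 0)

IsDSRG : (n k t λ' μ : ℕ) → Mat n → Set
IsDSRG n k t λ' μ M =
  IsDigraphAdj M
  × (∀ i j → (M · M) i j ≡
        (+ t ℤ.* I i j) ℤ.+ (+ λ' ℤ.* M i j) ℤ.+ (+ μ ℤ.* (J i j ℤ.- I i j ℤ.- M i j)))
  × (∀ i j → (M · J) i j ≡ + k ℤ.* J i j)
  × (∀ i j → (J · M) i j ≡ + k ℤ.* J i j)

block : {m : ℕ} → Mat m → Mat m → Mat m → Mat m → Mat (m + m)
block {m} P Q R S i j with splitAt m i | splitAt m j
... | inj₁ a | inj₁ b = P a b
... | inj₁ a | inj₂ b = Q a b
... | inj₂ a | inj₁ b = R a b
... | inj₂ a | inj₂ b = S a b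

-- Let D(A) = [[A, Aᵀ], [A, Aᵀ]]. Its two row halves coincide, so an entry of D(A)² is
-- row a of A + Aᵀ = J − I applied to the upper half of a column of D(A): that column's
-- sum minus one entry of D(A). In a regular tournament of order 2k+1 the in-degrees are
-- k as well, so every such column sum is k and D(A)² = kJ − D(A), which is the DSRG
-- identity for t = k, λ = k − 1, μ = k. The second matrix is the converse of D(Aᵀ);
-- Aᵀ is again a regular tournament, and the converse of a DSRG is a DSRG with the same
-- parameters.
module Submission where

open import Defs
open import Data.Empty using (⊥-elim)
open import Data.Fin using (Fin; zero; suc; splitAt; _↑ˡ_; _↑ʳ_)
open import Data.Fin.Properties
  using (suc-injective; splitAt-↑ˡ; splitAt-↑ʳ; splitAt⁻¹-↑ˡ; splitAt⁻¹-↑ʳ)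
  renaming (_≟_ to _≟ᶠ_)
open import Data.Nat as Nat using (ℕ)
import Data.Nat.Properties as Natₚ
open import Data.Product using (_×_; _,_; proj₁; proj₂)
open import Data.Sum using (_⊎_; inj₁; inj₂)
open import Function using (_∘_)
open import Relation.Binary.PropositionalEquality
  using (_≡_; _≢_; refl; sym; trans; cong; cong₂; subst; module ≡-Reasoning)
open import Relation.Nullary using (Dec; yes; no)

-- Integer arithmetic is opened only in this block, leaving _+_ and _*_ to ℕ in lemma2.
module _ where

  open import Data.Integer using (ℤ; +_; _+_; _-_; _*_)
  open import Data.Integer.Properties
    using (pos-+; +-identityˡ; +-identityʳ; +-assoc; *-comm; *-identityˡ; *-identityʳ;
           *-zeroˡ; *-distribʳ-+; +-0-abelianGroup)
  open import Data.Integer.Tactic.RingSolver using (solve-∀)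
  open import Algebra.Properties.AbelianGroup +-0-abelianGroup using (∙-cancelˡ)

  ∑-cong : ∀ {n} {f g : Fin n → ℤ} → (∀ c → f c ≡ g c) → ∑ f ≡ ∑ g
  ∑-cong {Nat.zero} e = refl
  ∑-cong {Nat.suc n} e = cong₂ _+_ (e zero) (∑-cong (e ∘ suc))

  ∑-distrib-+ : ∀ {n} (f g : Fin n → ℤ) → ∑ (λ c → f c + g c) ≡ ∑ f + ∑ g
  ∑-distrib-+ {Nat.zero} f g = refl
  ∑-distrib-+ {Nat.suc n} f g =
    trans (cong (λ s → f zero + g zero + s) (∑-distrib-+ (f ∘ suc) (g ∘ suc)))
          (interchange (f zero) (g zero) (∑ (f ∘ suc)) (∑ (g ∘ suc)))
    where
    interchange : ∀ a b x y → a + b + (x + y) ≡ a + x + (b + y)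
    interchange = solve-∀

  ∑-distrib-- : ∀ {n} (f g : Fin n → ℤ) → ∑ (λ c → f c - g c) ≡ ∑ f - ∑ g
  ∑-distrib-- {Nat.zero} f g = refl
  ∑-distrib-- {Nat.suc n} f g =
    trans (cong (λ s → f zero - g zero + s) (∑-distrib-- (f ∘ suc) (g ∘ suc)))
          (interchange (f zero) (g zero) (∑ (f ∘ suc)) (∑ (g ∘ suc)))
    where
    interchange : ∀ a b x y → a - b + (x - y) ≡ a + x - (b + y)
    interchange = solve-∀

  ∑-zero : ∀ {n} (f : Fin n → ℤ) → (∀ c → f c ≡ + 0) → ∑ f ≡ + 0
  ∑-zero {Nat.zero} f e = refl
  ∑-zero {Nat.suc n} f e = cong₂ _+_ (e zero) (∑-zero (f ∘ suc) (e ∘ suc))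

  ∑-supported-at : ∀ {n} (f : Fin n → ℤ) a → (∀ c → c ≢ a → f c ≡ + 0) → ∑ f ≡ f a
  ∑-supported-at {Nat.suc n} f zero e =
    trans (cong (λ s → f zero + s) (∑-zero (f ∘ suc) (λ c → e (suc c) λ ()))) (+-identityʳ (f zero))
  ∑-supported-at {Nat.suc n} f (suc a) e =
    trans (cong₂ _+_ (e zero λ ()) (∑-supported-at (f ∘ suc) a λ c c≢a → e (suc c) (c≢a ∘ suc-injective)))
          (+-identityˡ (f (suc a)))

  ∑-*1 : ∀ {n} (f : Fin n → ℤ) → ∑ (λ c → f c * + 1) ≡ ∑ f
  ∑-*1 f = ∑-cong (λ c → *-identityʳ (f c))

  ∑-1* : ∀ {n} (f : Fin n → ℤ) → ∑ (λ c → + 1 * f c) ≡ ∑ f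
  ∑-1* f = ∑-cong (λ c → *-identityˡ (f c))

  ∑-const-1 : ∀ n → ∑ {n} (λ _ → + 1) ≡ + n
  ∑-const-1 Nat.zero = refl
  ∑-const-1 (Nat.suc n) = trans (cong (λ s → + 1 + s) (∑-const-1 n)) (sym (pos-+ 1 n))

  ∑-↑ : ∀ {m n} (f : Fin (m Nat.+ n) → ℤ) → ∑ f ≡ ∑ (λ c → f (c ↑ˡ n)) + ∑ (λ c → f (m ↑ʳ c))
  ∑-↑ {Nat.zero} f = sym (+-identityˡ (∑ f))
  ∑-↑ {Nat.suc m} {n} f =
    trans (cong (λ s → f zero + s) (∑-↑ {m} {n} (f ∘ suc))) (sym (+-assoc (f zero) _ _))

  pos-2* : ∀ d → + (2 Nat.* d) ≡ + d + + d
  pos-2* d = trans (cong (λ x → + (d Nat.+ x)) (Natₚ.+-identityʳ d)) (pos-+ d d)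

  δ-diag : ∀ {n} (a : Fin n) → δ a a ≡ + 1
  δ-diag a with a ≟ᶠ a
  ... | yes _ = refl
  ... | no a≢a = ⊥-elim (a≢a refl)

  δ-≢ : ∀ {n} {a c : Fin n} → a ≢ c → δ a c ≡ + 0
  δ-≢ {a = a} {c} a≢c with a ≟ᶠ c
  ... | yes a≡c = ⊥-elim (a≢c a≡c)
  ... | no _ = refl

  δ-sym : ∀ {n} (a c : Fin n) → δ a c ≡ δ c a
  δ-sym a c = by-cases (a ≟ᶠ c)
    where
    by-cases : Dec (a ≡ c) → δ a c ≡ δ c a
    by-cases (yes a≡c) = subst (λ x → δ a x ≡ δ x a) a≡c refl
    by-cases (no a≢c) = trans (δ-≢ a≢c) (sym (δ-≢ (a≢c ∘ sym)))

  ∑-δ : ∀ {n} (a : Fin n) (g : Fin n → ℤ) → ∑ (λ c → δ a c * g c) ≡ g a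
  ∑-δ a g = begin
    ∑ (λ c → δ a c * g c) ≡⟨ ∑-supported-at _ a off-diagonal ⟩
    δ a a * g a           ≡⟨ cong (_* g a) (δ-diag a) ⟩
    + 1 * g a             ≡⟨ *-identityˡ (g a) ⟩
    g a                   ∎
    where
    open ≡-Reasoning
    off-diagonal : ∀ c → c ≢ a → δ a c * g c ≡ + 0
    off-diagonal c c≢a = trans (cong (_* g c) (δ-≢ (c≢a ∘ sym))) (*-zeroˡ (g c))

  data SplitView {m n : ℕ} : Fin (m Nat.+ n) → Set where
    left  : (a : Fin m) → SplitView (a ↑ˡ n)
    right : (b : Fin n) → SplitView (m ↑ʳ b)

  splitView : ∀ {m n} (i : Fin (m Nat.+ n)) → SplitView {m} {n} i
  splitView {m} i with splitAt m i in eq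
  ... | inj₁ a = subst SplitView (splitAt⁻¹-↑ˡ eq) (left a)
  ... | inj₂ b = subst SplitView (splitAt⁻¹-↑ʳ eq) (right b)

  module _ {m : ℕ} (P Q R S : Mat m) where

    block-↑ˡ-↑ˡ : ∀ a b → block P Q R S (a ↑ˡ m) (b ↑ˡ m) ≡ P a b
    block-↑ˡ-↑ˡ a b rewrite splitAt-↑ˡ m a m | splitAt-↑ˡ m b m = refl

    block-↑ˡ-↑ʳ : ∀ a b → block P Q R S (a ↑ˡ m) (m ↑ʳ b) ≡ Q a b
    block-↑ˡ-↑ʳ a b rewrite splitAt-↑ˡ m a m | splitAt-↑ʳ m m b = refl

    block-↑ʳ-↑ˡ : ∀ a b → block P Q R S (m ↑ʳ a) (b ↑ˡ m) ≡ R a b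
    block-↑ʳ-↑ˡ a b rewrite splitAt-↑ʳ m m a | splitAt-↑ˡ m b m = refl

    block-↑ʳ-↑ʳ : ∀ a b → block P Q R S (m ↑ʳ a) (m ↑ʳ b) ≡ S a b
    block-↑ʳ-↑ʳ a b rewrite splitAt-↑ʳ m m a | splitAt-↑ʳ m m b = refl

    ∑-block-↑ˡ-row : ∀ a (g : Fin (m Nat.+ m) → ℤ) →
      ∑ (λ l → block P Q R S (a ↑ˡ m) l * g l)
        ≡ ∑ (λ c → P a c * g (c ↑ˡ m)) + ∑ (λ c → Q a c * g (m ↑ʳ c))
    ∑-block-↑ˡ-row a g = trans (∑-↑ {m} {m} _)
      (cong₂ _+_ (∑-cong λ c → cong (_* g (c ↑ˡ m)) (block-↑ˡ-↑ˡ a c))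
                 (∑-cong λ c → cong (_* g (m ↑ʳ c)) (block-↑ˡ-↑ʳ a c)))

  block-ᵀ : ∀ {m} (P Q R S : Mat m) i j → (block P Q R S ᵀ) i j ≡ block (P ᵀ) (R ᵀ) (Q ᵀ) (S ᵀ) i j
  block-ᵀ {m} P Q R S i j with splitView {m} {m} i | splitView {m} {m} j
  ... | left a  | left b  = trans (block-↑ˡ-↑ˡ P Q R S b a) (sym (block-↑ˡ-↑ˡ (P ᵀ) (R ᵀ) (Q ᵀ) (S ᵀ) a b))
  ... | left a  | right b = trans (block-↑ʳ-↑ˡ P Q R S b a) (sym (block-↑ˡ-↑ʳ (P ᵀ) (R ᵀ) (Q ᵀ) (S ᵀ) a b))
  ... | right a | left b  = trans (block-↑ˡ-↑ʳ P Q R S b a) (sym (block-↑ʳ-↑ˡ (P ᵀ) (R ᵀ) (Q ᵀ) (S ᵀ) a b))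
  ... | right a | right b = trans (block-↑ʳ-↑ʳ P Q R S b a) (sym (block-↑ʳ-↑ʳ (P ᵀ) (R ᵀ) (Q ᵀ) (S ᵀ) a b))

  IsBit : ℤ → Set
  IsBit x = x ≡ + 0 ⊎ x ≡ + 1

  block-zeroOne : ∀ {m} {P Q R S : Mat m} → IsZeroOne P → IsZeroOne Q → IsZeroOne R → IsZeroOne S →
    IsZeroOne (block P Q R S)
  block-zeroOne {m} {P} {Q} {R} {S} P01 Q01 R01 S01 i j with splitView {m} {m} i | splitView {m} {m} j
  ... | left a  | left b  = subst IsBit (sym (block-↑ˡ-↑ˡ P Q R S a b)) (P01 a b)
  ... | left a  | right b = subst IsBit (sym (block-↑ˡ-↑ʳ P Q R S a b)) (Q01 a b)
  ... | right a | left b  = subst IsBit (sym (block-↑ʳ-↑ˡ P Q R S a b)) (R01 a b)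
  ... | right a | right b = subst IsBit (sym (block-↑ʳ-↑ʳ P Q R S a b)) (S01 a b)

  block-diag-zero : ∀ {m} {P Q R S : Mat m} → (∀ a → P a a ≡ + 0) → (∀ a → S a a ≡ + 0) →
    ∀ i → block P Q R S i i ≡ + 0
  block-diag-zero {m} {P} {Q} {R} {S} P-diag S-diag i with splitView {m} {m} i
  ... | left a  = trans (block-↑ˡ-↑ˡ P Q R S a a) (P-diag a)
  ... | right a = trans (block-↑ʳ-↑ʳ P Q R S a a) (S-diag a)

  tournament-diag : ∀ {n} {A : Mat n} → IsTournament A → ∀ a → A a a ≡ + 0
  tournament-diag (zeroOne , arcs) a with zeroOne a a
  ... | inj₁ A≡0 = A≡0
  ... | inj₂ A≡1 =
    ⊥-elim (2≢0 (trans (sym (cong₂ _+_ A≡1 A≡1)) (trans (arcs a a) (cong (λ x → + 1 - x) (δ-diag a)))))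
    where
    2≢0 : + 2 ≢ + 0
    2≢0 ()

  ∑-out+in : ∀ {n} {A : Mat n} → IsTournament A → ∀ a (g : Fin n → ℤ) →
    ∑ (λ c → A a c * g c) + ∑ (λ c → A c a * g c) ≡ ∑ g - g a
  ∑-out+in {A = A} (_ , arcs) a g = begin
    ∑ (λ c → A a c * g c) + ∑ (λ c → A c a * g c) ≡⟨ sym (∑-distrib-+ (λ c → A a c * g c) (λ c → A c a * g c)) ⟩
    ∑ (λ c → A a c * g c + A c a * g c)           ≡⟨ ∑-cong summand ⟩
    ∑ (λ c → g c - δ a c * g c)                   ≡⟨ ∑-distrib-- g _ ⟩
    ∑ g - ∑ (λ c → δ a c * g c)                   ≡⟨ cong (λ x → ∑ g - x) (∑-δ a g) ⟩
    ∑ g - g a                                     ∎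
    where
    open ≡-Reasoning
    expand : ∀ x y → (+ 1 - x) * y ≡ y - x * y
    expand = solve-∀
    summand : ∀ c → A a c * g c + A c a * g c ≡ g c - δ a c * g c
    summand c = trans (sym (*-distribʳ-+ (g c) (A a c) (A c a)))
                      (trans (cong (_* g c) (arcs a c)) (expand (δ a c) (g c)))

  regular⇒indeg : ∀ {d} {A : Mat (2 Nat.* d Nat.+ 1)} → IsRegularTournament A d →
    ∀ b → outdeg (A ᵀ) b ≡ + d
  regular⇒indeg {d} {A} (tournament , outdeg≡d) b = ∙-cancelˡ (+ d) _ _ (begin
    + d + outdeg (A ᵀ) b                                  ≡⟨ cong (_+ outdeg (A ᵀ) b) (sym (outdeg≡d b)) ⟩
    outdeg A b + outdeg (A ᵀ) b                           ≡⟨ sym (cong₂ _+_ (∑-*1 (A b)) (∑-*1 (λ c → A c b))) ⟩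
    ∑ (λ c → A b c * + 1) + ∑ (λ c → A c b * + 1)         ≡⟨ ∑-out+in tournament b (λ _ → + 1) ⟩
    ∑ {2 Nat.* d Nat.+ 1} (λ _ → + 1) - + 1               ≡⟨ cong (λ x → x - + 1) (∑-const-1 (2 Nat.* d Nat.+ 1)) ⟩
    + (2 Nat.* d Nat.+ 1) - + 1                           ≡⟨ cong (λ x → x - + 1) (pos-+ (2 Nat.* d) 1) ⟩
    + (2 Nat.* d) + + 1 - + 1                             ≡⟨ +1-1 (+ (2 Nat.* d)) ⟩
    + (2 Nat.* d)                                         ≡⟨ pos-2* d ⟩
    + d + + d                                             ∎)
    where
    open ≡-Reasoning
    +1-1 : ∀ x → x + + 1 - + 1 ≡ x
    +1-1 = solve-∀

  regular-ᵀ : ∀ {d} {A : Mat (2 Nat.* d Nat.+ 1)} → IsRegularTournament A d → IsRegularTournament (A ᵀ) d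
  regular-ᵀ regular@((zeroOne , arcs) , _) =
    ((λ i j → zeroOne j i) , λ i j → trans (arcs j i) (cong (λ x → + 1 - x) (δ-sym j i))) ,
    regular⇒indeg regular

  square⇒IsDSRG : ∀ {n} d k {M : Mat n} → IsDigraphAdj M →
    (∀ i j → (M · M) i j ≡ + Nat.suc k - M i j) →
    (∀ i j → (M · J) i j ≡ + d) → (∀ i j → (J · M) i j ≡ + d) →
    IsDSRG n d (Nat.suc k) k (Nat.suc k) M
  square⇒IsDSRG d k {M} adjacency square MJ JM =
    adjacency ,
    (λ i j → trans (square i j) (dsrg-identity (+ k) (I i j) (M i j))) ,
    (λ i j → trans (MJ i j) (sym (*-identityʳ (+ d)))) ,
    (λ i j → trans (JM i j) (sym (*-identityʳ (+ d))))
    where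
    -- k is a ring variable here: + 1 + + k reduces to + suc k.
    dsrg-identity : ∀ k x y → + 1 + k - y ≡ (+ 1 + k) * x + k * y + (+ 1 + k) * (+ 1 - x - y)
    dsrg-identity = solve-∀

  isDSRG-ᵀ : ∀ {n d t λ' μ} {M : Mat n} → IsDSRG n d t λ' μ M → IsDSRG n d t λ' μ (M ᵀ)
  isDSRG-ᵀ {t = t} {λ'} {μ} {M} ((zeroOne , loopless) , square , MJ , JM) =
    ((λ i j → zeroOne j i) , loopless) ,
    square-ᵀ ,
    (λ i j → trans (∑-cong λ l → *-comm (M l i) (+ 1)) (JM j i)) ,
    (λ i j → trans (∑-cong λ l → *-comm (+ 1) (M j l)) (MJ j i))
    where
    square-ᵀ : ∀ i j → ((M ᵀ) · (M ᵀ)) i j ≡ + t * I i j + + λ' * M j i + + μ * (J i j - I i j - M j i)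
    square-ᵀ i j =
      trans (∑-cong λ l → *-comm (M l i) (M j l))
            (trans (square j i) (cong (λ x → + t * x + + λ' * M j i + + μ * (+ 1 - x - M j i)) (δ-sym j i)))

  isDSRG-resp : ∀ {n d t λ' μ} {M N : Mat n} → (∀ i j → M i j ≡ N i j) →
    IsDSRG n d t λ' μ M → IsDSRG n d t λ' μ N
  isDSRG-resp {t = t} {λ'} {μ} {M} {N} M≡N ((zeroOne , loopless) , square , MJ , JM) =
    ((λ i j → subst IsBit (M≡N i j) (zeroOne i j)) ,
     (λ i → trans (sym (M≡N i i)) (loopless i))) ,
    (λ i j → trans (∑-cong λ l → sym (cong₂ _*_ (M≡N i l) (M≡N l j)))
                   (trans (square i j) (cong (λ x → + t * I i j + + λ' * x + + μ * (J i j - I i j - x)) (M≡N i j)))) ,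
    (λ i j → trans (∑-cong λ l → cong (_* + 1) (sym (M≡N i l))) (MJ i j)) ,
    (λ i j → trans (∑-cong λ l → cong (λ x → + 1 * x) (sym (M≡N l j))) (JM i j))

  module Doubling {d : ℕ} {A : Mat (2 Nat.* d Nat.+ 1)} (regular : IsRegularTournament A d) where

    m : ℕ
    m = 2 Nat.* d Nat.+ 1

    upper lower : Fin m → Fin (m Nat.+ m)
    upper a = a ↑ˡ m
    lower a = m ↑ʳ a

    D : Mat (m Nat.+ m)
    D = block A (A ᵀ) A (A ᵀ)

    rows-agree : ∀ a j → D (lower a) j ≡ D (upper a) j
    rows-agree a j with splitView {m} {m} j
    ... | left b  = trans (block-↑ʳ-↑ˡ A (A ᵀ) A (A ᵀ) a b) (sym (block-↑ˡ-↑ˡ A (A ᵀ) A (A ᵀ) a b))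
    ... | right b = trans (block-↑ʳ-↑ʳ A (A ᵀ) A (A ᵀ) a b) (sym (block-↑ˡ-↑ʳ A (A ᵀ) A (A ᵀ) a b))

    ·-rows-agree : ∀ (M : Mat (m Nat.+ m)) a j → (D · M) (lower a) j ≡ (D · M) (upper a) j
    ·-rows-agree M a j = ∑-cong λ l → cong (_* M l j) (rows-agree a l)

    upper-column-sum : ∀ j → ∑ (λ c → D (upper c) j) ≡ + d
    upper-column-sum j with splitView {m} {m} j
    ... | left b  = trans (∑-cong λ c → block-↑ˡ-↑ˡ A (A ᵀ) A (A ᵀ) c b) (regular⇒indeg regular b)
    ... | right b = trans (∑-cong λ c → block-↑ˡ-↑ʳ A (A ᵀ) A (A ᵀ) c b) (proj₂ regular b)

    upper-square : ∀ a j → (D · D) (upper a) j ≡ + d - D (upper a) j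
    upper-square a j = begin
      (D · D) (upper a) j
        ≡⟨ ∑-block-↑ˡ-row A (A ᵀ) A (A ᵀ) a (λ l → D l j) ⟩
      ∑ (λ c → A a c * D (upper c) j) + ∑ (λ c → A c a * D (lower c) j)
        ≡⟨ cong (λ x → ∑ (λ c → A a c * D (upper c) j) + x) (∑-cong λ c → cong (A c a *_) (rows-agree c j)) ⟩
      ∑ (λ c → A a c * D (upper c) j) + ∑ (λ c → A c a * D (upper c) j)
        ≡⟨ ∑-out+in (proj₁ regular) a (λ c → D (upper c) j) ⟩
      ∑ (λ c → D (upper c) j) - D (upper a) j
        ≡⟨ cong (λ x → x - D (upper a) j) (upper-column-sum j) ⟩
      + d - D (upper a) j ∎
      where open ≡-Reasoning

    square : ∀ i j → (D · D) i j ≡ + d - D i j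
    square i j with splitView {m} {m} i
    ... | left a  = upper-square a j
    ... | right a = trans (·-rows-agree D a j)
                          (trans (upper-square a j) (cong (λ x → + d - x) (sym (rows-agree a j))))

    upper-row-sum : ∀ a j → (D · J) (upper a) j ≡ + (2 Nat.* d)
    upper-row-sum a j = begin
      (D · J) (upper a) j                            ≡⟨ ∑-block-↑ˡ-row A (A ᵀ) A (A ᵀ) a (λ _ → + 1) ⟩
      ∑ (λ c → A a c * + 1) + ∑ (λ c → A c a * + 1) ≡⟨ cong₂ _+_ (∑-*1 (A a)) (∑-*1 (λ c → A c a)) ⟩
      outdeg A a + outdeg (A ᵀ) a                    ≡⟨ cong₂ _+_ (proj₂ regular a) (regular⇒indeg regular a) ⟩
      + d + + d                                      ≡⟨ sym (pos-2* d) ⟩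
      + (2 Nat.* d)                                  ∎
      where open ≡-Reasoning

    row-sum : ∀ i j → (D · J) i j ≡ + (2 Nat.* d)
    row-sum i j with splitView {m} {m} i
    ... | left a  = upper-row-sum a j
    ... | right a = trans (·-rows-agree J a j) (upper-row-sum a j)

    column-sum : ∀ i j → (J · D) i j ≡ + (2 Nat.* d)
    column-sum i j = begin
      (J · D) i j                                         ≡⟨ ∑-1* (λ l → D l j) ⟩
      ∑ (λ l → D l j)                                     ≡⟨ ∑-↑ {m} {m} (λ l → D l j) ⟩
      ∑ (λ c → D (upper c) j) + ∑ (λ c → D (lower c) j)   ≡⟨ cong (λ x → ∑ (λ c → D (upper c) j) + x)
                                                                (∑-cong λ c → rows-agree c j) ⟩
      ∑ (λ c → D (upper c) j) + ∑ (λ c → D (upper c) j)   ≡⟨ cong₂ _+_ (upper-column-sum j) (upper-column-sum j) ⟩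
      + d + + d                                           ≡⟨ sym (pos-2* d) ⟩
      + (2 Nat.* d)                                       ∎
      where open ≡-Reasoning

  isDSRG-doubling : ∀ {k} {A : Mat (2 Nat.* Nat.suc k Nat.+ 1)} → IsRegularTournament A (Nat.suc k) →
    IsDSRG ((2 Nat.* Nat.suc k Nat.+ 1) Nat.+ (2 Nat.* Nat.suc k Nat.+ 1)) (2 Nat.* Nat.suc k)
           (Nat.suc k) k (Nat.suc k) (block A (A ᵀ) A (A ᵀ))
  isDSRG-doubling {k} regular@(tournament@(zeroOne , _) , _) =
    square⇒IsDSRG (2 Nat.* Nat.suc k) k
      (block-zeroOne zeroOne (λ i j → zeroOne j i) zeroOne (λ i j → zeroOne j i) ,
       block-diag-zero (tournament-diag tournament) (tournament-diag tournament))
      square row-sum column-sum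
    where open Doubling regular

open import Data.Nat using (suc; _+_; _*_; _∸_; _≥_)

lemma2 : (k : ℕ) → k ≥ 1 → (A : Mat (2 * k + 1)) → IsRegularTournament A k →
    IsDSRG ((2 * k + 1) + (2 * k + 1)) (2 * k) k (k ∸ 1) k (block A (A ᵀ) A (A ᵀ))
    × IsDSRG ((2 * k + 1) + (2 * k + 1)) (2 * k) k (k ∸ 1) k (block A A (A ᵀ) (A ᵀ))
lemma2 (suc k) _ A regular =
  isDSRG-doubling regular ,
  isDSRG-resp {d = 2 * suc k} {suc k} {k} {suc k} (block-ᵀ (A ᵀ) A (A ᵀ) A)
    (isDSRG-ᵀ {d = 2 * suc k} {suc k} {k} {suc k} (isDSRG-doubling (regular-ᵀ regular)))
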